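{- Let $G=(V,E)$ be a graph, $H$ a demand graph, and $\varphi$ an integral $H$-flow in $G$. Then $\mathsf{con}_2(\varphi)\geq\sqrt{\mathrm{inter}(\varphi)}$.
   Context: An integral $H$-flow in $G$ is given by an injective map $g:V(H)\to V$ together with, for each edge $(i,j)\in E(H)$, a single path $\varphi_{ij}$ in $G$ between $g(i)$ and $g(j)$ carrying one unit of flow. The vertex congestion at $v\in V$ is $C_\varphi(v)=\#\{(i,j)\in E(H): v\in\varphi_{ij}\}$, and $\mathsf{con}_2(\varphi)=\left(\sum_{v\in V}C_\varphi(v)^2\right)^{1/2}$. $\mathrm{inter}(\varphi)$ is the number of pairs of edges $(i,j),(i',j')\in E(H)$ with $|\{i,j,i',j'\}|=4$ and $\varphi_{ij}\cap\varphi_{i'j'}\neq\emptyset$ (paths regarded as vertex sets). -}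

module Defs where

open import Data.Nat using (ℕ; _*_)
open import Data.Fin using (Fin; _<_; _<?_)
open import Data.Fin.Properties using (_≟_)
open import Data.List using (List; []; _∷_; length; filter; allFin; map)
open import Data.Nat.ListAction using (sum)
open import Data.List.Relation.Unary.Any using (Any; any?)
open import Data.List.Relation.Unary.Unique.Propositional using (Unique)
open import Data.List.Membership.Propositional using (_∈_)
open import Data.Product using (_×_; _,_)
open import Data.Sum using (_⊎_)
open import Relation.Binary.PropositionalEquality using (_≡_)
open import Relation.Nullary using (¬_; Dec)
open import Relation.Nullary.Decidable using (_×-dec_; ¬?)

record Graph (n : ℕ) : Set₁ where
  field
    Adj    : Fin n → Fin n → Set
    sym    : ∀ {u v} → Adj u v → Adj v u
    irrefl : ∀ {v} → ¬ Adj v v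

record DemandGraph (k : ℕ) : Set where
  field
    m          : ℕ
    src        : Fin m → Fin k
    tgt        : Fin m → Fin k
    loopless   : ∀ e → ¬ (src e ≡ tgt e)
    noParallel : ∀ e e' →
                 ((src e ≡ src e' × tgt e ≡ tgt e') ⊎ (src e ≡ tgt e' × tgt e ≡ src e')) →
                 e ≡ e'

data Walk {n : ℕ} (G : Graph n) : Fin n → Fin n → List (Fin n) → Set where
  here : ∀ a → Walk G a a (a ∷ [])
  step : ∀ {a b c vs} → Graph.Adj G a b → Walk G b c vs → Walk G a c (a ∷ vs)

record Path {n : ℕ} (G : Graph n) (a b : Fin n) : Set where
  field
    verts  : List (Fin n)
    walk   : Walk G a b verts
    simple : Unique verts

open Path public

record IntegralFlow {n k : ℕ} (G : Graph n) (H : DemandGraph k) : Set where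
  field
    g     : Fin k → Fin n
    g-inj : ∀ i j → g i ≡ g j → i ≡ j
    φ     : (e : Fin (DemandGraph.m H)) →
            Path G (g (DemandGraph.src H e)) (g (DemandGraph.tgt H e))

count : ∀ {m} {P : Fin m → Set} → (∀ x → Dec (P x)) → ℕ
count {m} P? = length (filter P? (allFin m))

_∈?_ : ∀ {n} (v : Fin n) (xs : List (Fin n)) → Dec (v ∈ xs)
v ∈? xs = any? (λ u → v ≟ u) xs

module _ {n k : ℕ} {G : Graph n} {H : DemandGraph k} (F : IntegralFlow G H) where
  open DemandGraph H
  open IntegralFlow F

  pathVerts : Fin m → List (Fin n)
  pathVerts e = verts (φ e)

  congestion : Fin n → ℕ
  congestion v = count (λ e → v ∈? pathVerts e)

  con₂² : ℕ
  con₂² = sum (map (λ v → congestion v * congestion v) (allFin n))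

  FourDistinct : Fin m → Fin m → Set
  FourDistinct e e' = ¬ (src e ≡ src e') × ¬ (src e ≡ tgt e') ×
                      ¬ (tgt e ≡ src e') × ¬ (tgt e ≡ tgt e')

  fourDistinct? : ∀ e e' → Dec (FourDistinct e e')
  fourDistinct? e e' = ¬? (src e ≟ src e') ×-dec ¬? (src e ≟ tgt e') ×-dec
                       ¬? (tgt e ≟ src e') ×-dec ¬? (tgt e ≟ tgt e')

  Intersect : Fin m → Fin m → Set
  Intersect e e' = Any (λ v → v ∈ pathVerts e') (pathVerts e)

  intersect? : ∀ e e' → Dec (Intersect e e')
  intersect? e e' = any? (λ v → v ∈? pathVerts e') (pathVerts e)

  -- inter(φ): number of unordered pairs {e, e'} of edges of H (counted
  -- once, as e < e') with four distinct endpoints and intersecting paths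
  inter : ℕ
  inter = sum (map (λ e → count (λ e' →
            (e <? e') ×-dec (fourDistinct? e e' ×-dec intersect? e e')))
          (allFin m))

-- Summing the indicator of "v lies on both φ_e and φ_e'" over all vertices v
-- and all ordered pairs (e, e') gives Σ_v C_φ(v)², since the inner double sum
-- factors as C_φ(v) · C_φ(v).  Every pair counted by inter(φ) has
-- intersecting paths, so it contributes at least 1 to this sum.
module Submission where

open import Defs
open import Data.Fin using (Fin; zero; suc; _<_; _<?_)
open import Data.List using (List; length; filter; tabulate; map; allFin)
open import Data.List.Properties using (map-tabulate)
open import Data.List.Membership.Propositional using (_∈_; find)
open import Data.List.Relation.Unary.Any using (any?)
import Data.Nat.ListAction as ListAction
open import Data.Nat using (ℕ; _≤_; _+_; _*_; z≤n)
open import Data.Nat.Properties using (≤-trans; ≤-reflexive; m≤m+n; +-mono-≤; +-*-semiring; module ≤-Reasoning)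
open import Algebra.Properties.Semiring.Sum +-*-semiring
  using (sum; sum-syntax; sum-cong-≗; sum-remove; ∑-comm; *-distribˡ-sum; *-distribʳ-sum)
open import Data.Product using (_×_; _,_; proj₂)
open import Function using (_∘_)
open import Relation.Binary.PropositionalEquality
open import Relation.Nullary using (Dec; yes; no; contradiction)
open import Relation.Nullary.Decidable using (_×-dec_)

𝟙 : ∀ {a} {P : Set a} → Dec P → ℕ
𝟙 (yes _) = 1
𝟙 (no _)  = 0

𝟙-yes : ∀ {a} {P : Set a} (p? : Dec P) → P → 𝟙 p? ≡ 1
𝟙-yes (yes _) _ = refl
𝟙-yes (no ¬p) p = contradiction p ¬p

𝟙-mono : ∀ {a b} {P : Set a} {Q : Set b} → (P → Q) →
         (p? : Dec P) (q? : Dec Q) → 𝟙 p? ≤ 𝟙 q?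
𝟙-mono P⇒Q (yes p) q? = ≤-reflexive (sym (𝟙-yes q? (P⇒Q p)))
𝟙-mono P⇒Q (no _)  q? = z≤n

∑-mono-≤ : ∀ {n} {f g : Fin n → ℕ} → (∀ i → f i ≤ g i) → ∑[ i < n ] f i ≤ ∑[ i < n ] g i
∑-mono-≤ {ℕ.zero}  f≤g = z≤n
∑-mono-≤ {ℕ.suc _} f≤g = +-mono-≤ (f≤g zero) (∑-mono-≤ (f≤g ∘ suc))

term≤∑ : ∀ {n} (f : Fin n → ℕ) (i : Fin n) → f i ≤ ∑[ j < n ] f j
term≤∑ {ℕ.suc _} f i = ≤-trans (m≤m+n (f i) _) (≤-reflexive (sym (sum-remove {i = i} f)))

∑*∑ : ∀ {m n} (f : Fin m → ℕ) (g : Fin n → ℕ) →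
      (∑[ i < m ] f i) * (∑[ j < n ] g j) ≡ ∑[ i < m ] ∑[ j < n ] (f i * g j)
∑*∑ f g = trans (*-distribʳ-sum (sum g) f)
                (sum-cong-≗ (λ i → *-distribˡ-sum (f i) g))

∑∑∑-co-occurrence≡∑-square : ∀ {m n} (a : Fin n → Fin m → ℕ) →
    ∑[ e < m ] ∑[ e' < m ] ∑[ v < n ] (a v e * a v e') ≡
    ∑[ v < n ] ((∑[ e < m ] a v e) * (∑[ e < m ] a v e))
∑∑∑-co-occurrence≡∑-square {m} a = begin
  ∑[ e < m ] ∑[ e' < m ] ∑[ v < _ ] (a v e * a v e')
    ≡⟨ sum-cong-≗ (λ e → ∑-comm (λ e' v → a v e * a v e')) ⟩
  ∑[ e < m ] ∑[ v < _ ] ∑[ e' < m ] (a v e * a v e')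
    ≡⟨ ∑-comm (λ e v → ∑[ e' < m ] (a v e * a v e')) ⟩
  ∑[ v < _ ] ∑[ e < m ] ∑[ e' < m ] (a v e * a v e')
    ≡⟨ sum-cong-≗ (λ v → ∑*∑ (a v) (a v)) ⟨
  ∑[ v < _ ] ((∑[ e < m ] a v e) * (∑[ e < m ] a v e)) ∎
  where open ≡-Reasoning

sum-tabulate : ∀ {n} (f : Fin n → ℕ) → ListAction.sum (tabulate f) ≡ ∑[ i < n ] f i
sum-tabulate {ℕ.zero}  f = refl
sum-tabulate {ℕ.suc _} f = cong (f zero +_) (sum-tabulate (f ∘ suc))

sum-map-allFin : ∀ {n} (f : Fin n → ℕ) → ListAction.sum (map f (allFin n)) ≡ ∑[ i < n ] f i
sum-map-allFin f = trans (cong ListAction.sum (map-tabulate (λ i → i) f)) (sum-tabulate f)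

length-filter-tabulate : ∀ {a p} {A : Set a} {P : A → Set p} (P? : ∀ x → Dec (P x))
                         {n} (f : Fin n → A) →
                         length (filter P? (tabulate f)) ≡ ∑[ i < n ] 𝟙 (P? (f i))
length-filter-tabulate P? {ℕ.zero}  f = refl
length-filter-tabulate P? {ℕ.suc _} f with P? (f zero)
... | yes _ = cong ℕ.suc (length-filter-tabulate P? (f ∘ suc))
... | no _  = length-filter-tabulate P? (f ∘ suc)

count≡∑𝟙 : ∀ {m} {P : Fin m → Set} (P? : ∀ i → Dec (P i)) → count P? ≡ ∑[ i < m ] 𝟙 (P? i)
count≡∑𝟙 P? = length-filter-tabulate P? (λ i → i)

𝟙-overlap≤∑-common : ∀ {n} (xs ys : List (Fin n)) →
                     𝟙 (any? (λ v → v ∈? ys) xs) ≤ ∑[ v < n ] (𝟙 (v ∈? xs) * 𝟙 (v ∈? ys))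
𝟙-overlap≤∑-common xs ys with any? (λ v → v ∈? ys) xs
... | no _ = z≤n
... | yes common with find common
... | v , v∈xs , v∈ys = subst (_≤ ∑[ u < _ ] (𝟙 (u ∈? xs) * 𝟙 (u ∈? ys)))
        (cong₂ _*_ (𝟙-yes (v ∈? xs) v∈xs) (𝟙-yes (v ∈? ys) v∈ys))
        (term≤∑ (λ u → 𝟙 (u ∈? xs) * 𝟙 (u ∈? ys)) v)

lemma3p8 : ∀ {n k : ℕ} (G : Graph n) (H : DemandGraph k) (φ : IntegralFlow G H) →
           inter φ ≤ con₂² φ
lemma3p8 {n} G H F = begin
  inter F
    ≡⟨ sum-map-allFin (λ e → count (counted? e)) ⟩
  ∑[ e < m ] count (λ e' → counted? e e')
    ≡⟨ sum-cong-≗ (λ e → count≡∑𝟙 (counted? e)) ⟩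
  ∑[ e < m ] ∑[ e' < m ] 𝟙 (counted? e e')
    ≤⟨ ∑-mono-≤ (λ e → ∑-mono-≤ (λ e' →
         𝟙-mono (proj₂ ∘ proj₂) (counted? e e') (intersect? F e e'))) ⟩
  ∑[ e < m ] ∑[ e' < m ] 𝟙 (intersect? F e e')
    ≤⟨ ∑-mono-≤ (λ e → ∑-mono-≤ (λ e' → 𝟙-overlap≤∑-common (pathVerts F e) (pathVerts F e'))) ⟩
  ∑[ e < m ] ∑[ e' < m ] ∑[ v < n ] (on v e * on v e')
    ≡⟨ ∑∑∑-co-occurrence≡∑-square on ⟩
  ∑[ v < n ] ((∑[ e < m ] on v e) * (∑[ e < m ] on v e))
    ≡⟨ sum-cong-≗ (λ v → cong₂ _*_ (count≡∑𝟙 (on? v)) (count≡∑𝟙 (on? v))) ⟨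
  ∑[ v < n ] (congestion F v * congestion F v)
    ≡⟨ sum-map-allFin (λ v → congestion F v * congestion F v) ⟨
  con₂² F ∎
  where
  open ≤-Reasoning
  open DemandGraph H using (m)
  counted? : ∀ e e' → Dec (e < e' × FourDistinct F e e' × Intersect F e e')
  counted? e e' = (e <? e') ×-dec (fourDistinct? F e e' ×-dec intersect? F e e')
  on? : ∀ v e → Dec (v ∈ pathVerts F e)
  on? v e = v ∈? pathVerts F e
  on : Fin n → Fin m → ℕ
  on v e = 𝟙 (on? v e)
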